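{- Let $n\geq 1$ and let $S\subset\mathbb{F}_2^n$ be a $(3,2)$-orthogonal set with respect to the dot product such that $\bm{x}\cdot\bm{x}=0$ for every $\bm{x}\in S$. Then \[ |S|\leq\begin{cases}2^{\frac{n+1}{2}}-2, & \text{if } n \text{ is odd};\\ 2^{\frac n2+1}-3, & \text{if } n \text{ is even}.\end{cases} \]
   Context: The dot product is $\bm{x}\cdot\bm{y}=\sum_i x_iy_i$ over $\mathbb{F}_2$. $S\subset\mathbb{F}_2^n\setminus\{\bm{0}\}$ is $(3,2)$-orthogonal if among any three distinct elements of $S$ at least two, say $\bm{x},\bm{y}$, satisfy $\bm{x}\cdot\bm{y}=0$. -}

module Defs where

open import Data.Bool using (Bool; true; false; _xor_; _∧_)
open import Data.Nat using (ℕ; zero; suc; _+_; _*_; _^_)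
open import Data.Vec using (Vec; []; _∷_; replicate)
open import Data.List using (List)
open import Data.List.Membership.Propositional using (_∈_)
open import Data.List.Relation.Unary.All using (All)
open import Data.List.Relation.Unary.Unique.Propositional using (Unique)
open import Data.Product using (_×_)
open import Data.Sum using (_⊎_)
open import Relation.Binary.PropositionalEquality using (_≡_; _≢_)

-- Vectors in F₂ⁿ are Vec Bool n (true = 1, false = 0, xor = addition, ∧ = product).

_·_ : ∀ {n} → Vec Bool n → Vec Bool n → Bool
[] · [] = false
(a ∷ x) · (b ∷ y) = (a ∧ b) xor (x · y)

𝟎 : ∀ n → Vec Bool n
𝟎 n = replicate n false

-- (3,2)-orthogonality of a finite set S ⊆ F₂ⁿ \ {0}, given as a duplicate-free list:
-- every element is nonzero, and among any three distinct elements some two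
-- distinct ones among them are orthogonal.
Is32Orthogonal : ∀ {n} → List (Vec Bool n) → Set
Is32Orthogonal {n} S =
  All (λ x → x ≢ 𝟎 n) S ×
  (∀ x y z → x ∈ S → y ∈ S → z ∈ S → x ≢ y → y ≢ z → x ≢ z →
     (x · y ≡ false) ⊎ (y · z ≡ false) ⊎ (x · z ≡ false))

-- The (3,2) condition says that the graph joining non-orthogonal elements of S has no triangle;
-- 𝟎 is adjoined to S, costing one in the bound but letting the totally isotropic sets below contain 𝟎.
-- The induction runs inside the orthogonal complement of a hyperbolic system P (isotropic pairs
-- with aᵢ · bᵢ = 1, different pairs orthogonal). Since 𝟏 and P span 2^(2|P|+1)
-- vectors, 2|P| < n, and the measure is s with n ≤ 2(s + |P|) + 1.
-- A totally isotropic set I ⊆ P^⊥ has at most 2^s elements: unless I ⊆ {𝟎, 𝟏}, some x ∈ I has an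
-- isotropic partner y ⊥ P with y · x = 1, and I splits into its elements orthogonal to y and the
-- others translated by x, both totally isotropic in the complement of (y , x) ∷ P.
-- A triangle-free set S ⊆ P^⊥ of isotropic vectors is either totally isotropic or has an edge
-- x · y = 1. The neighbours of x, and the remaining neighbours of y, are then totally isotropic
-- (translate them by y, resp. x), while the rest is triangle-free in the complement of (x , y) ∷ P.
-- This gives |S| + e < 2^(s+1), where e = 1 is the extra room when n is even.

module Submission where

open import Defs
open import Algebra using (CommutativeRing)
open import Data.Bool using (Bool; true; false; not; _xor_; _∧_)
open import Data.Bool.Properties
  using (¬-not; not-¬; not-involutive; ∧-comm; ∧-zeroʳ; ∧-identityʳ; ∧-idem; ∧-distribˡ-xor;
         xor-same; xor-identityʳ; xor-assoc; xor-∧-commutativeRing)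
  renaming (_≟_ to _≟ᵇ_)
open import Data.Nat using (ℕ; zero; suc; _+_; _*_; _^_; _≤_; _<_; z≤n; s≤s; NonZero; >-nonZero)
open import Data.Nat.Properties
  using (+-suc; +-identityʳ; +-comm; +-assoc; *-suc; ≤-trans; ≤-reflexive; ≤-antisym; ≤-pred; +-mono-≤;
         +-mono-≤-<; m≤m+n; m+1+n≰m; 1+n≰n; *-cancelˡ-≤; *-monoʳ-≤; m^n>0; ^-monoʳ-<; ≮⇒≥; <⇒≱;
         module ≤-Reasoning)
open import Data.Vec using (Vec; []; _∷_; replicate; zipWith)
open import Data.Vec.Properties using (≡-dec)
open import Data.List using (List; []; _∷_; [_]; length; map; _++_; filter)
open import Data.List.Properties using (length-++; length-map; length-++-sucʳ)
open import Data.List.Membership.Propositional using (_∈_; find)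
open import Data.List.Membership.Propositional.Properties
  using (∈-∃++; ∈-++⁻; ∈-++⁺ˡ; ∈-++⁺ʳ; ∈-map⁻; ∈-map⁺; ∈-filter⁻)
open import Data.List.Relation.Binary.Disjoint.Propositional using (Disjoint)
open import Data.List.Relation.Binary.Subset.Propositional using (_⊆_)
open import Data.List.Relation.Binary.Subset.Propositional.Properties using (filter-⊆)
open import Data.List.Relation.Unary.Any using (here; there)
open import Data.List.Relation.Unary.All as All using (All; []; _∷_; all?)
import Data.List.Relation.Unary.All.Properties as AllP
open import Data.List.Relation.Unary.Unique.Propositional using (Unique; []; _∷_)
import Data.List.Relation.Unary.Unique.Propositional.Properties as Unique
open import Data.Product using (∃-syntax; ∃₂; _×_; _,_; proj₁; proj₂)
open import Data.Sum using (_⊎_; inj₁; inj₂)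
open import Function using (_∘_)
open import Level using (0ℓ)
open import Relation.Nullary using (¬_; Dec; yes; no; contradiction; _⊎-dec_)
open import Relation.Unary using (Pred; Decidable)
open import Relation.Unary.Properties using (∁?)
open import Relation.Binary.PropositionalEquality
  using (_≡_; _≢_; refl; sym; trans; cong; cong₂; subst; subst₂; module ≡-Reasoning)

open CommutativeRing xor-∧-commutativeRing using () renaming (+-commutativeSemigroup to xor-commutativeSemigroup)
open import Algebra.Properties.CommutativeSemigroup xor-commutativeSemigroup
  using () renaming (interchange to xor-interchange)

private
  variable
    n : ℕ
    a b e w x y : Vec Bool n

m+m≡2*m : ∀ m → m + m ≡ 2 * m
m+m≡2*m m = cong (m +_) (sym (+-identityʳ m))

2≤2^suc : ∀ s → 2 ≤ 2 ^ suc s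
2≤2^suc s = *-monoʳ-≤ 2 (m^n>0 2 s)

+-mono-≤-2* : ∀ {a b m} → a ≤ m → b ≤ m → a + b ≤ 2 * m
+-mono-≤-2* {m = m} a≤m b≤m = ≤-trans (+-mono-≤ a≤m b≤m) (≤-reflexive (m+m≡2*m m))

≤-shift-suc : ∀ {m} s k → m ≤ suc (2 * (suc s + k)) → m ≤ suc (2 * (s + suc k))
≤-shift-suc {m} s k = subst (λ t → m ≤ suc (2 * t)) (sym (+-suc s k))

2*[1+k]<m⇒m≰1+2*k : ∀ {m} k → 2 * suc k < m → ¬ m ≤ suc (2 * k)
2*[1+k]<m⇒m≰1+2*k k 2k+2<m m≤2k+1 = 1+n≰n (*-cancelˡ-≤ 2 (≤-pred (≤-trans 2k+2<m m≤2k+1)))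

parity-slack : ∀ {m e} s k → e ≤ 1 → 2 * k < m → m + e ≤ suc (2 * (s + k)) → e < 2 ^ s
parity-slack         zero    k z≤n       _    _   = s≤s z≤n
parity-slack {m = m} zero    k (s≤s z≤n) 2k<m m+1≤ = contradiction (≤-trans m+1≤ 2k<m) (m+1+n≰m m)
parity-slack         (suc s) k e≤1       _    _   = ≤-trans (s≤s e≤1) (2≤2^suc s)

module _ {A : Set} where

  unique-⊆⇒length≤ : ∀ {xs ys : List A} → Unique xs → xs ⊆ ys → length xs ≤ length ys
  unique-⊆⇒length≤ {[]} _ _ = z≤n
  unique-⊆⇒length≤ {x ∷ xs} (x∉xs ∷ uxs) x∷xs⊆ys with ∈-∃++ (x∷xs⊆ys (here refl))
  ... | us , vs , refl = begin
    suc (length xs)          ≤⟨ s≤s (unique-⊆⇒length≤ uxs xs⊆us++vs) ⟩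
    suc (length (us ++ vs))  ≡⟨ length-++-sucʳ us x vs ⟨
    length (us ++ x ∷ vs)    ∎
    where
    open ≤-Reasoning
    xs⊆us++vs : xs ⊆ us ++ vs
    xs⊆us++vs {z} z∈xs with ∈-++⁻ us (x∷xs⊆ys (there z∈xs))
    ... | inj₁ z∈us          = ∈-++⁺ˡ z∈us
    ... | inj₂ (here refl)   = contradiction refl (All.lookup x∉xs z∈xs)
    ... | inj₂ (there z∈vs)  = ∈-++⁺ʳ us z∈vs

  length-filter+∁ : ∀ {P : Pred A 0ℓ} (P? : Decidable P) xs →
                    length xs ≡ length (filter P? xs) + length (filter (∁? P?) xs)
  length-filter+∁ P? [] = refl
  length-filter+∁ P? (x ∷ xs) with P? x
  ... | yes _ = cong suc (length-filter+∁ P? xs)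
  ... | no  _ = trans (cong suc (length-filter+∁ P? xs)) (sym (+-suc _ _))

vectors : ∀ n → List (Vec Bool n)
vectors zero    = [ [] ]
vectors (suc n) = map (true ∷_) (vectors n) ++ map (false ∷_) (vectors n)

∈-vectors : ∀ (x : Vec Bool n) → x ∈ vectors n
∈-vectors []                  = here refl
∈-vectors (true ∷ x)          = ∈-++⁺ˡ (∈-map⁺ (true ∷_) (∈-vectors x))
∈-vectors {suc n} (false ∷ x) = ∈-++⁺ʳ (map (true ∷_) (vectors n)) (∈-map⁺ (false ∷_) (∈-vectors x))

length-vectors : ∀ n → length (vectors n) ≡ 2 ^ n
length-vectors zero    = refl
length-vectors (suc n) = begin
  length (map (true ∷_) vs ++ map (false ∷_) vs)        ≡⟨ length-++ (map (true ∷_) vs) ⟩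
  length (map (true ∷_) vs) + length (map (false ∷_) vs) ≡⟨ cong₂ _+_ (length-map _ vs) (length-map _ vs) ⟩
  length vs + length vs                                  ≡⟨ m+m≡2*m (length vs) ⟩
  2 * length vs                                          ≡⟨ cong (2 *_) (length-vectors n) ⟩
  2 ^ suc n                                              ∎
  where
  open ≡-Reasoning
  vs = vectors n

infixl 6 _⊕_
_⊕_ : Vec Bool n → Vec Bool n → Vec Bool n
_⊕_ = zipWith _xor_

𝟏 : ∀ n → Vec Bool n
𝟏 n = replicate n true

infix 4 _⟂_
_⟂_ : Vec Bool n → Vec Bool n → Set
x ⟂ y = x · y ≡ false

Isotropic : Vec Bool n → Set
Isotropic x = x ⟂ x

·-comm : ∀ (x y : Vec Bool n) → x · y ≡ y · x
·-comm [] [] = refl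
·-comm (a ∷ x) (b ∷ y) = cong₂ _xor_ (∧-comm a b) (·-comm x y)

·-zeroʳ : ∀ (x : Vec Bool n) → x ⟂ 𝟎 n
·-zeroʳ [] = refl
·-zeroʳ (a ∷ x) rewrite ∧-zeroʳ a = ·-zeroʳ x

·-zeroˡ : ∀ (x : Vec Bool n) → 𝟎 n ⟂ x
·-zeroˡ [] = refl
·-zeroˡ (a ∷ x) = ·-zeroˡ x

·-𝟏 : ∀ (x : Vec Bool n) → x · 𝟏 n ≡ x · x
·-𝟏 [] = refl
·-𝟏 (a ∷ x) = cong₂ _xor_ (trans (∧-identityʳ a) (sym (∧-idem a))) (·-𝟏 x)

·-distribˡ-⊕ : ∀ (x y z : Vec Bool n) → x · (y ⊕ z) ≡ (x · y) xor (x · z)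
·-distribˡ-⊕ [] [] [] = refl
·-distribˡ-⊕ (a ∷ x) (b ∷ y) (c ∷ z) = begin
  (a ∧ (b xor c)) xor (x · (y ⊕ z))               ≡⟨ cong₂ _xor_ (∧-distribˡ-xor a b c) (·-distribˡ-⊕ x y z) ⟩
  ((a ∧ b) xor (a ∧ c)) xor ((x · y) xor (x · z)) ≡⟨ xor-interchange (a ∧ b) (a ∧ c) (x · y) (x · z) ⟩
  ((a ∧ b) xor (x · y)) xor ((a ∧ c) xor (x · z)) ∎
  where open ≡-Reasoning

·-distribʳ-⊕ : ∀ (x y z : Vec Bool n) → (x ⊕ y) · z ≡ (x · z) xor (y · z)
·-distribʳ-⊕ x y z = begin
  (x ⊕ y) · z          ≡⟨ ·-comm (x ⊕ y) z ⟩
  z · (x ⊕ y)          ≡⟨ ·-distribˡ-⊕ z x y ⟩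
  (z · x) xor (z · y)  ≡⟨ cong₂ _xor_ (·-comm z x) (·-comm z y) ⟩
  (x · z) xor (y · z)  ∎
  where open ≡-Reasoning

-- The cross terms x · y and y · x cancel.
·-⊕-self : ∀ (x y : Vec Bool n) → (x ⊕ y) · (x ⊕ y) ≡ (x · x) xor (y · y)
·-⊕-self x y = begin
  (x ⊕ y) · (x ⊕ y)                                ≡⟨ ·-distribʳ-⊕ x y (x ⊕ y) ⟩
  (x · (x ⊕ y)) xor (y · (x ⊕ y))                  ≡⟨ cong₂ _xor_ (·-distribˡ-⊕ x x y) (·-distribˡ-⊕ y x y) ⟩
  ((x · x) xor (x · y)) xor ((y · x) xor (y · y))  ≡⟨ cong (λ t → ((x · x) xor (x · y)) xor (t xor (y · y))) (·-comm y x) ⟩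
  ((x · x) xor (x · y)) xor ((x · y) xor (y · y))  ≡⟨ xor-assoc (x · x) (x · y) ((x · y) xor (y · y)) ⟩
  (x · x) xor ((x · y) xor ((x · y) xor (y · y)))  ≡⟨ cong ((x · x) xor_) (sym (xor-assoc (x · y) (x · y) (y · y))) ⟩
  (x · x) xor (((x · y) xor (x · y)) xor (y · y))  ≡⟨ cong (λ t → (x · x) xor (t xor (y · y))) (xor-same (x · y)) ⟩
  (x · x) xor (y · y)                              ∎
  where open ≡-Reasoning

x⊕y⊕y≡x : ∀ (x y : Vec Bool n) → x ⊕ y ⊕ y ≡ x
x⊕y⊕y≡x [] [] = refl
x⊕y⊕y≡x (a ∷ x) (b ∷ y) =
  cong₂ _∷_ (trans (xor-assoc a b b) (trans (cong (a xor_) (xor-same b)) (xor-identityʳ a))) (x⊕y⊕y≡x x y)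

⊕-cancelʳ-≡ : ∀ (z : Vec Bool n) → x ⊕ z ≡ y ⊕ z → x ≡ y
⊕-cancelʳ-≡ {x = x} {y = y} z eq = begin
  x          ≡⟨ sym (x⊕y⊕y≡x x z) ⟩
  x ⊕ z ⊕ z  ≡⟨ cong (_⊕ z) eq ⟩
  y ⊕ z ⊕ z  ≡⟨ x⊕y⊕y≡x y z ⟩
  y          ∎
  where open ≡-Reasoning

⟂-⊕ˡ : ∀ (x y w : Vec Bool n) → x ⟂ w → y ⟂ w → x ⊕ y ⟂ w
⟂-⊕ˡ x y w x⟂w y⟂w = trans (·-distribʳ-⊕ x y w) (cong₂ _xor_ x⟂w y⟂w)

⊕-⟂-⊕ : ∀ (x y w : Vec Bool n) → x ⟂ y → x ⟂ w → y ⟂ w → Isotropic w → x ⊕ w ⟂ y ⊕ w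
⊕-⟂-⊕ x y w x⟂y x⟂w y⟂w w⟂w = begin
  (x ⊕ w) · (y ⊕ w)                                 ≡⟨ ·-distribʳ-⊕ x w (y ⊕ w) ⟩
  (x · (y ⊕ w)) xor (w · (y ⊕ w))                   ≡⟨ cong₂ _xor_ (·-distribˡ-⊕ x y w) (·-distribˡ-⊕ w y w) ⟩
  ((x · y) xor (x · w)) xor ((w · y) xor (w · w))   ≡⟨ cong₂ _xor_ (cong₂ _xor_ x⟂y x⟂w)
                                                                   (cong₂ _xor_ (trans (·-comm w y) y⟂w) w⟂w) ⟩
  false                                             ∎
  where open ≡-Reasoning

𝟏·𝟏-odd : ∀ k → 𝟏 (suc (2 * k)) · 𝟏 (suc (2 * k)) ≡ true
𝟏·𝟏-odd zero = refl
𝟏·𝟏-odd (suc k) = begin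
  𝟏 (suc (2 * suc k)) · 𝟏 (suc (2 * suc k))          ≡⟨ cong (λ m → 𝟏 (suc m) · 𝟏 (suc m)) (*-suc 2 k) ⟩
  not (not (𝟏 (suc (2 * k)) · 𝟏 (suc (2 * k))))      ≡⟨ not-involutive _ ⟩
  𝟏 (suc (2 * k)) · 𝟏 (suc (2 * k))                  ≡⟨ 𝟏·𝟏-odd k ⟩
  true                                               ∎
  where open ≡-Reasoning

infix 4 _≟ᵥ_
_≟ᵥ_ : ∀ (x y : Vec Bool n) → Dec (x ≡ y)
_≟ᵥ_ = ≡-dec _≟ᵇ_

infixl 7 _*ᵥ_
_*ᵥ_ : Bool → Vec Bool n → Vec Bool n
true  *ᵥ v = v
false *ᵥ v = 𝟎 _

*ᵥ-· : ∀ c (v x : Vec Bool n) → (c *ᵥ v) · x ≡ c ∧ (v · x)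
*ᵥ-· true  v x = refl
*ᵥ-· false v x = ·-zeroˡ x

*ᵥ-isotropic : ∀ {n} {x : Vec Bool n} c → Isotropic x → Isotropic (c *ᵥ x)
*ᵥ-isotropic true x⟂x = x⟂x
*ᵥ-isotropic {n = n} false _ = ·-zeroˡ (𝟎 n)

-- The witness is a standard basis vector at a coordinate where x differs from c.
∃-unit : ∀ c (x : Vec Bool n) → x ≢ replicate n c → ∃[ u ] u · u ≡ true × u · x ≡ not c
∃-unit c [] x≢c = contradiction refl x≢c
∃-unit {n = suc n} c (a ∷ x) a∷x≢c with a ≟ᵇ c
... | yes refl = let u , u·u , u·x = ∃-unit a x (a∷x≢c ∘ cong (a ∷_)) in false ∷ u , u·u , u·x
... | no a≢c   = true ∷ 𝟎 n , cong not (·-zeroˡ (𝟎 n)) ,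
                 trans (cong₂ _xor_ (¬-not a≢c) (·-zeroˡ x)) (xor-identityʳ (not c))

∃-isotropic-partner : x ≢ 𝟎 n → x ≢ 𝟏 n → ∃[ e ] Isotropic e × e · x ≡ true
∃-isotropic-partner {x = x} x≢𝟎 x≢𝟏 =
  let u , u·u , u·x = ∃-unit false x x≢𝟎
      v , v·v , v·x = ∃-unit true x x≢𝟏
  in u ⊕ v , trans (·-⊕-self u v) (cong₂ _xor_ u·u v·v) , trans (·-distribʳ-⊕ u v x) (cong₂ _xor_ u·x v·x)

shear : Vec Bool n → Vec Bool n → Vec Bool n → Vec Bool n
shear a b e = e ⊕ (e · b) *ᵥ a

shear-⟂ : ∀ (a b e : Vec Bool n) → a · b ≡ true → shear a b e ⟂ b
shear-⟂ a b e a·b = begin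
  (e ⊕ (e · b) *ᵥ a) · b          ≡⟨ ·-distribʳ-⊕ e _ b ⟩
  (e · b) xor (((e · b) *ᵥ a) · b)  ≡⟨ cong ((e · b) xor_) (*ᵥ-· (e · b) a b) ⟩
  (e · b) xor ((e · b) ∧ (a · b)) ≡⟨ cong (λ t → (e · b) xor ((e · b) ∧ t)) a·b ⟩
  (e · b) xor ((e · b) ∧ true)    ≡⟨ cong ((e · b) xor_) (∧-identityʳ (e · b)) ⟩
  (e · b) xor (e · b)             ≡⟨ xor-same (e · b) ⟩
  false                           ∎
  where open ≡-Reasoning

shear-· : ∀ (a b e : Vec Bool n) → w ⟂ a → shear a b e · w ≡ e · w
shear-· {w = w} a b e w⟂a = begin
  (e ⊕ (e · b) *ᵥ a) · w          ≡⟨ ·-distribʳ-⊕ e _ w ⟩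
  (e · w) xor (((e · b) *ᵥ a) · w)  ≡⟨ cong ((e · w) xor_) (*ᵥ-· (e · b) a w) ⟩
  (e · w) xor ((e · b) ∧ (a · w)) ≡⟨ cong (λ t → (e · w) xor ((e · b) ∧ t)) (trans (·-comm a w) w⟂a) ⟩
  (e · w) xor ((e · b) ∧ false)   ≡⟨ cong ((e · w) xor_) (∧-zeroʳ (e · b)) ⟩
  (e · w) xor false               ≡⟨ xor-identityʳ (e · w) ⟩
  e · w                           ∎
  where open ≡-Reasoning

shear-isotropic : ∀ (a b e : Vec Bool n) → Isotropic a → Isotropic e → Isotropic (shear a b e)
shear-isotropic a b e a⟂a e⟂e =
  trans (·-⊕-self e _) (cong₂ _xor_ e⟂e (*ᵥ-isotropic (e · b) a⟂a))

-- Hyperbolic systems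

Pairs : ℕ → Set
Pairs n = List (Vec Bool n × Vec Bool n)

infix 4 _⟂ᴾ_
_⟂ᴾ_ : Vec Bool n → Pairs n → Set
w ⟂ᴾ P = All (λ p → w ⟂ proj₁ p × w ⟂ proj₂ p) P

data IsHyperbolic {n} : Pairs n → Set where
  []     : IsHyperbolic []
  extend : ∀ {a b P} → Isotropic a → Isotropic b → a · b ≡ true → a ⟂ᴾ P → b ⟂ᴾ P → IsHyperbolic P →
           IsHyperbolic ((a , b) ∷ P)

𝟎-⟂ᴾ : ∀ (P : Pairs n) → 𝟎 n ⟂ᴾ P
𝟎-⟂ᴾ = All.universal (λ (a , b) → ·-zeroˡ a , ·-zeroˡ b)

⟂ᴾ-⊕ : ∀ (x y : Vec Bool n) {P} → x ⟂ᴾ P → y ⟂ᴾ P → x ⊕ y ⟂ᴾ P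
⟂ᴾ-⊕ x y x⟂P y⟂P = All.zipWith
  (λ { {a , b} ((x⟂a , x⟂b) , (y⟂a , y⟂b)) → ⟂-⊕ˡ x y a x⟂a y⟂a , ⟂-⊕ˡ x y b x⟂b y⟂b }) (x⟂P , y⟂P)

*ᵥ-⟂ᴾ : ∀ c (x : Vec Bool n) {P} → x ⟂ᴾ P → c *ᵥ x ⟂ᴾ P
*ᵥ-⟂ᴾ true  x x⟂P = x⟂P
*ᵥ-⟂ᴾ false x {P} _ = 𝟎-⟂ᴾ P

shear-⟂ᴾ : ∀ (a b e : Vec Bool n) {P} → e ⟂ᴾ P → a ⟂ᴾ P → shear a b e ⟂ᴾ P
shear-⟂ᴾ a b e e⟂P a⟂P = ⟂ᴾ-⊕ e _ e⟂P (*ᵥ-⟂ᴾ (e · b) a a⟂P)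

∃-hyperbolic-partner : ∀ {P : Pairs n} → IsHyperbolic P → x ⟂ᴾ P → x ≢ 𝟎 n → x ≢ 𝟏 n →
                       ∃[ y ] Isotropic y × y ⟂ᴾ P × y · x ≡ true
∃-hyperbolic-partner {P = []} _ _ x≢𝟎 x≢𝟏 =
  let e , e⟂e , e·x = ∃-isotropic-partner x≢𝟎 x≢𝟏 in e , e⟂e , [] , e·x
∃-hyperbolic-partner {P = (a , b) ∷ P} (extend a⟂a b⟂b a·b a⟂P b⟂P hP) ((x⟂a , x⟂b) ∷ x⟂P) x≢𝟎 x≢𝟏 =
  let y , y⟂y , y⟂P , y·x = ∃-hyperbolic-partner hP x⟂P x≢𝟎 x≢𝟏
      y′ = shear a b y
  in shear b a y′ ,
     shear-isotropic b a y′ b⟂b (shear-isotropic a b y a⟂a y⟂y) ,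
     (shear-⟂ b a y′ (trans (·-comm b a) a·b) , trans (shear-· b a y′ b⟂b) (shear-⟂ a b y a·b)) ∷
       shear-⟂ᴾ b a y′ (shear-⟂ᴾ a b y y⟂P a⟂P) b⟂P ,
     trans (shear-· b a y′ x⟂b) (trans (shear-· a b y x⟂a) y·x)

swap-hyperbolic : ∀ {P : Pairs n} → IsHyperbolic ((a , b) ∷ P) → IsHyperbolic ((b , a) ∷ P)
swap-hyperbolic (extend {a} {b} a⟂a b⟂b a·b a⟂P b⟂P hP) = extend b⟂b a⟂a (trans (·-comm b a) a·b) b⟂P a⟂P hP

∃-hyperbolic-extension : ∀ {P : Pairs n} → IsHyperbolic P → Isotropic x → x ⟂ᴾ P → x ≢ 𝟎 n → x ≢ 𝟏 n →
                         ∃[ y ] IsHyperbolic ((y , x) ∷ P)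
∃-hyperbolic-extension hP x⟂x x⟂P x≢𝟎 x≢𝟏 =
  let y , y⟂y , y⟂P , y·x = ∃-hyperbolic-partner hP x⟂P x≢𝟎 x≢𝟏 in y , extend y⟂y x⟂x y·x y⟂P x⟂P hP

double : Vec Bool n → List (Vec Bool n) → List (Vec Bool n)
double v L = L ++ map (_⊕ v) L

length-double : ∀ (v : Vec Bool n) L → length (double v L) ≡ 2 * length L
length-double v L = trans (length-++ L) (trans (cong (length L +_) (length-map (_⊕ v) L)) (m+m≡2*m (length L)))

⟂-double : ∀ (w e : Vec Bool n) {L} → All (w ⟂_) L → w ⟂ e → All (w ⟂_) (double e L)
⟂-double w e w⟂L w⟂e =
  AllP.++⁺ w⟂L (AllP.map⁺ (All.map (λ {u} w⟂u → trans (·-distribˡ-⊕ w u e) (cong₂ _xor_ w⟂u w⟂e)) w⟂L))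

unique-double : ∀ (w e : Vec Bool n) {L} → Unique L → All (w ⟂_) L → w · e ≡ true → Unique (double e L)
unique-double w e {L} uL w⟂L w·e = Unique.++⁺ uL (Unique.map⁺ (⊕-cancelʳ-≡ e) uL) disjoint
  where
  disjoint : Disjoint L (map (_⊕ e) L)
  disjoint (u∈L , u∈L⊕e) with ∈-map⁻ (_⊕ e) u∈L⊕e
  ... | u , u∈L′ , refl = contradiction
    (trans (sym (All.lookup w⟂L u∈L)) (trans (·-distribˡ-⊕ w u e) (cong₂ _xor_ (All.lookup w⟂L u∈L′) w·e)))
    λ ()

span : Pairs n → List (Vec Bool n)
span {n} []        = double (𝟏 n) [ 𝟎 n ]
span ((a , b) ∷ P) = double b (double a (span P))

length-span : ∀ (P : Pairs n) → length (span P) ≡ 2 ^ suc (2 * length P)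
length-span [] = refl
length-span ((a , b) ∷ P) = begin
  length (double b (double a (span P)))  ≡⟨ length-double b (double a (span P)) ⟩
  2 * length (double a (span P))         ≡⟨ cong (2 *_) (length-double a (span P)) ⟩
  2 * (2 * length (span P))              ≡⟨ cong (λ m → 2 * (2 * m)) (length-span P) ⟩
  2 ^ suc (2 + 2 * length P)             ≡⟨ cong (λ m → 2 ^ suc m) (*-suc 2 (length P)) ⟨
  2 ^ suc (2 * suc (length P))           ∎
  where open ≡-Reasoning

⟂-span : ∀ (w : Vec Bool n) {P} → Isotropic w → w ⟂ᴾ P → All (w ⟂_) (span P)
⟂-span {n} w {[]} w⟂w [] = ⟂-double w (𝟏 n) (·-zeroʳ w ∷ []) (trans (·-𝟏 w) w⟂w)
⟂-span w {(a , b) ∷ P} w⟂w ((w⟂a , w⟂b) ∷ w⟂P) = ⟂-double w b (⟂-double w a (⟂-span w w⟂w w⟂P) w⟂a) w⟂b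

unique-span : ∀ {P : Pairs (suc n)} → IsHyperbolic P → Unique (span P)
unique-span {n} {[]} _ =
  unique-double (true ∷ 𝟎 n) (𝟏 (suc n)) ([] ∷ []) (·-zeroʳ (true ∷ 𝟎 n) ∷ []) (cong not (·-zeroˡ (𝟏 n)))
unique-span {P = (a , b) ∷ P} (extend a⟂a b⟂b a·b a⟂P b⟂P hP) =
  unique-double a b (unique-double b a (unique-span hP) (⟂-span b b⟂b b⟂P) (trans (·-comm b a) a·b))
                (⟂-double a a (⟂-span a a⟂a a⟂P) a⟂a) a·b

hyperbolic-bound : ∀ .{{_ : NonZero n}} {P : Pairs n} → IsHyperbolic P → 2 * length P < n
hyperbolic-bound {n = suc n} {P} hP = ≮⇒≥ λ n<2k+1 → <⇒≱ (^-monoʳ-< 2 (s≤s (s≤s z≤n)) n<2k+1) counted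
  where
  counted : 2 ^ suc (2 * length P) ≤ 2 ^ suc n
  counted = subst₂ _≤_ (length-span P) (length-vectors (suc n))
                   (unique-⊆⇒length≤ (unique-span hP) (λ {u} _ → ∈-vectors u))

-- Totally isotropic and triangle-free sets

TotallyIsotropic : List (Vec Bool n) → Set
TotallyIsotropic I = ∀ {x y} → x ∈ I → y ∈ I → x ⟂ y

TriangleFree : List (Vec Bool n) → Set
TriangleFree S = ∀ x y z → x ∈ S → y ∈ S → z ∈ S → x ≢ y → y ≢ z → x ≢ z → x ⟂ y ⊎ y ⟂ z ⊎ x ⟂ z

triangleFree-⊆ : ∀ {S T : List (Vec Bool n)} → T ⊆ S → TriangleFree S → TriangleFree T
triangleFree-⊆ T⊆S tf x y z x∈T y∈T z∈T = tf x y z (T⊆S x∈T) (T⊆S y∈T) (T⊆S z∈T)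

triangleFree-𝟎∷ : ∀ {S : List (Vec Bool n)} → TriangleFree S → TriangleFree (𝟎 n ∷ S)
triangleFree-𝟎∷ tf x y z (here refl)  _            _            = λ _ _ _ → inj₁ (·-zeroˡ y)
triangleFree-𝟎∷ tf x y z (there _)    (here refl)  _            = λ _ _ _ → inj₁ (·-zeroʳ x)
triangleFree-𝟎∷ tf x y z (there _)    (there _)    (here refl)  = λ _ _ _ → inj₂ (inj₁ (·-zeroʳ y))
triangleFree-𝟎∷ tf x y z (there x∈S)  (there y∈S)  (there z∈S)  = tf x y z x∈S y∈S z∈S

isotropic⇒≢ : ∀ (w x : Vec Bool n) → Isotropic w → x · w ≡ true → w ≢ x
isotropic⇒≢ w .w w⟂w w·w refl = not-¬ w·w w⟂w

common-neighbours-⟂ : ∀ {S : List (Vec Bool n)} → TriangleFree S → (∀ {z} → z ∈ S → Isotropic z) →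
                      w ∈ S → x ∈ S → y ∈ S → x · w ≡ true → y · w ≡ true → x ⟂ y
common-neighbours-⟂ {w = w} {x} {y} tf isotropic w∈S x∈S y∈S x·w y·w with x ≟ᵥ y
... | yes refl = isotropic x∈S
... | no x≢y with tf w x y w∈S x∈S y∈S (isotropic⇒≢ w x (isotropic w∈S) x·w) x≢y (isotropic⇒≢ w y (isotropic w∈S) y·w)
...   | inj₁ w⟂x        = contradiction (trans (·-comm x w) w⟂x) (not-¬ x·w)
...   | inj₂ (inj₁ x⟂y) = x⟂y
...   | inj₂ (inj₂ w⟂y) = contradiction (trans (·-comm y w) w⟂y) (not-¬ y·w)

totallyIsotropic-or-edge : ∀ (S : List (Vec Bool n)) → TotallyIsotropic S ⊎ ∃₂ λ x y → x ∈ S × y ∈ S × x · y ≡ true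
totallyIsotropic-or-edge S with all? (λ x → all? (λ y → x · y ≟ᵇ false) S) S
... | yes all⟂ = inj₁ λ x∈S y∈S → All.lookup (All.lookup all⟂ x∈S) y∈S
... | no ¬all⟂ =
  let x , x∈S , ¬x⟂S = find (AllP.¬All⇒Any¬ (λ x → all? (λ y → x · y ≟ᵇ false) S) S ¬all⟂)
      y , y∈S , ¬x⟂y = find (AllP.¬All⇒Any¬ (λ y → x · y ≟ᵇ false) S ¬x⟂S)
  in inj₂ (x , y , x∈S , y∈S , ¬-not ¬x⟂y)

⊆𝟎𝟏-or-∃ : ∀ (I : List (Vec Bool n)) → All (λ x → x ≡ 𝟎 n ⊎ x ≡ 𝟏 n) I ⊎ ∃[ x ] x ∈ I × x ≢ 𝟎 n × x ≢ 𝟏 n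
⊆𝟎𝟏-or-∃ {n} I with all? (λ x → x ≟ᵥ 𝟎 n ⊎-dec x ≟ᵥ 𝟏 n) I
... | yes I⊆𝟎𝟏 = inj₁ I⊆𝟎𝟏
... | no I⊈𝟎𝟏 =
  let x , x∈I , x∉𝟎𝟏 = find (AllP.¬All⇒Any¬ (λ x → x ≟ᵥ 𝟎 n ⊎-dec x ≟ᵥ 𝟏 n) I I⊈𝟎𝟏)
  in inj₂ (x , x∈I , x∉𝟎𝟏 ∘ inj₁ , x∉𝟎𝟏 ∘ inj₂)

record TotallyIsotropicIn (P : Pairs n) (I : List (Vec Bool n)) : Set where
  field
    unique           : Unique I
    orthogonal       : ∀ {z} → z ∈ I → z ⟂ᴾ P
    totallyIsotropic : TotallyIsotropic I

record TriangleFreeIn (P : Pairs n) (S : List (Vec Bool n)) : Set where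
  field
    unique       : Unique S
    orthogonal   : ∀ {z} → z ∈ S → z ⟂ᴾ P
    isotropic    : ∀ {z} → z ∈ S → Isotropic z
    triangleFree : TriangleFree S

translate-isotropic : ∀ {P : Pairs n} {N} → IsHyperbolic ((a , b) ∷ P) → Unique N →
                      (∀ {z} → z ∈ N → z · a ≡ true × z ⟂ b × z ⟂ᴾ P) → TotallyIsotropic N →
                      TotallyIsotropicIn ((a , b) ∷ P) (map (_⊕ b) N)
translate-isotropic (extend {a} {b} a⟂a b⟂b a·b a⟂P b⟂P hP) uN N-facts N-iso = record
  { unique           = Unique.map⁺ (⊕-cancelʳ-≡ b) uN
  ; orthogonal       = orthogonal
  ; totallyIsotropic = totallyIsotropic
  }
  where
  orthogonal : ∀ {u} → u ∈ map (_⊕ b) _ → u ⟂ᴾ ((a , b) ∷ _)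
  orthogonal u∈ with ∈-map⁻ (_⊕ b) u∈
  ... | z , z∈N , refl =
    let z·a , z⟂b , z⟂P = N-facts z∈N
    in (trans (·-distribʳ-⊕ z b a) (cong₂ _xor_ z·a (trans (·-comm b a) a·b)) , ⟂-⊕ˡ z b b z⟂b b⟂b) ∷ ⟂ᴾ-⊕ z b z⟂P b⟂P
  totallyIsotropic : TotallyIsotropic (map (_⊕ b) _)
  totallyIsotropic u∈ u′∈ with ∈-map⁻ (_⊕ b) u∈ | ∈-map⁻ (_⊕ b) u′∈
  ... | z , z∈N , refl | z′ , z′∈N , refl =
    ⊕-⟂-⊕ z z′ b (N-iso z∈N z′∈N) (proj₁ (proj₂ (N-facts z∈N))) (proj₁ (proj₂ (N-facts z′∈N))) b⟂b

translate-neighbours : ∀ {P : Pairs n} {S N} → IsHyperbolic ((a , b) ∷ P) → TriangleFreeIn P S → a ∈ S →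
                       Unique N → N ⊆ S → (∀ {z} → z ∈ N → z · a ≡ true × z ⟂ b) →
                       TotallyIsotropicIn ((a , b) ∷ P) (map (_⊕ b) N)
translate-neighbours hP′ S-tf a∈S uN N⊆S N-facts =
  translate-isotropic hP′ uN
    (λ z∈N → let z·a , z⟂b = N-facts z∈N in z·a , z⟂b , orthogonal (N⊆S z∈N))
    (λ z∈N z′∈N → common-neighbours-⟂ triangleFree isotropic a∈S (N⊆S z∈N) (N⊆S z′∈N)
                                        (proj₁ (N-facts z∈N)) (proj₁ (N-facts z′∈N)))
  where open TriangleFreeIn S-tf

split-isotropic : ∀ {P : Pairs n} {I} → IsHyperbolic ((y , x) ∷ P) → x ∈ I → TotallyIsotropicIn P I →
                  ∃₂ λ I₀ I₁ → length I ≡ length I₀ + length I₁ ×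
                               TotallyIsotropicIn ((y , x) ∷ P) I₀ × TotallyIsotropicIn ((y , x) ∷ P) I₁
split-isotropic {y = y} {x} {I = I} hP′ x∈I I-iso =
  I₀ , map (_⊕ x) I₁′ ,
  trans (length-filter+∁ ⟂y? I) (cong (length I₀ +_) (sym (length-map (_⊕ x) I₁′))) ,
  record { unique           = Unique.filter⁺ ⟂y? unique
         ; orthogonal       = λ z∈I₀ → let z∈I , z⟂y = ∈-filter⁻ ⟂y? z∈I₀
                                       in (z⟂y , totallyIsotropic z∈I x∈I) ∷ orthogonal z∈I
         ; totallyIsotropic = λ z∈ z′∈ → totallyIsotropic (filter-⊆ ⟂y? I z∈) (filter-⊆ ⟂y? I z′∈) } ,
  translate-isotropic hP′ (Unique.filter⁺ (∁? ⟂y?) unique)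
    (λ z∈I₁′ → let z∈I , ¬z⟂y = ∈-filter⁻ (∁? ⟂y?) z∈I₁′
               in ¬-not ¬z⟂y , totallyIsotropic z∈I x∈I , orthogonal z∈I)
    (λ z∈ z′∈ → totallyIsotropic (filter-⊆ (∁? ⟂y?) I z∈) (filter-⊆ (∁? ⟂y?) I z′∈))
  where
  open TotallyIsotropicIn I-iso
  ⟂y? : Decidable (_⟂ y)
  ⟂y? z = z · y ≟ᵇ false
  I₀ = filter ⟂y? I
  I₁′ = filter (∁? ⟂y?) I

split-triangle-free : ∀ {P : Pairs n} {S} → IsHyperbolic ((x , y) ∷ P) → x ∈ S → y ∈ S → TriangleFreeIn P S →
                      ∃[ X ] ∃[ Y ] ∃[ T ] length S ≡ length X + (length Y + length T) ×
                        TotallyIsotropicIn ((x , y) ∷ P) X × TotallyIsotropicIn ((y , x) ∷ P) Y × TriangleFreeIn ((x , y) ∷ P) T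
split-triangle-free {x = x} {y} {S = S} hP′@(extend _ _ x·y _ _ _) x∈S y∈S S-tf =
  map (_⊕ y) X₀ , map (_⊕ x) Y₀ , T , |S|≡ ,
  translate-neighbours hP′ S-tf x∈S (Unique.filter⁺ x-nbr? unique) X₀⊆S X₀-facts ,
  translate-neighbours (swap-hyperbolic hP′) S-tf y∈S (Unique.filter⁺ y-nbr? (Unique.filter⁺ (∁? x-nbr?) unique))
                       Y₀⊆S Y₀-facts ,
  record { unique       = Unique.filter⁺ (∁? y-nbr?) (Unique.filter⁺ (∁? x-nbr?) unique)
         ; orthogonal   = λ z∈T → let z∈R , ¬z·y = ∈-filter⁻ (∁? y-nbr?) {xs = R} z∈T
                                      z∈S , ¬z·x = ∈-filter⁻ (∁? x-nbr?) {xs = S} z∈R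
                                  in (¬-not ¬z·x , ¬-not ¬z·y) ∷ orthogonal z∈S
         ; isotropic    = isotropic ∘ T⊆S
         ; triangleFree = triangleFree-⊆ T⊆S triangleFree }
  where
  open TriangleFreeIn S-tf
  x-nbr? : Decidable (λ z → z · x ≡ true)
  x-nbr? z = z · x ≟ᵇ true
  y-nbr? : Decidable (λ z → z · y ≡ true)
  y-nbr? z = z · y ≟ᵇ true
  X₀ = filter x-nbr? S
  R  = filter (∁? x-nbr?) S
  Y₀ = filter y-nbr? R
  T  = filter (∁? y-nbr?) R
  X₀⊆S : X₀ ⊆ S
  X₀⊆S = filter-⊆ x-nbr? S
  X₀-facts : ∀ {z} → z ∈ X₀ → z · x ≡ true × z ⟂ y
  X₀-facts z∈X₀ = let z∈S , z·x = ∈-filter⁻ x-nbr? {xs = S} z∈X₀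
                  in z·x , common-neighbours-⟂ triangleFree isotropic x∈S z∈S y∈S z·x (trans (·-comm y x) x·y)
  Y₀⊆S : Y₀ ⊆ S
  Y₀⊆S = filter-⊆ (∁? x-nbr?) S ∘ filter-⊆ y-nbr? R
  Y₀-facts : ∀ {z} → z ∈ Y₀ → z · y ≡ true × z ⟂ x
  Y₀-facts z∈Y₀ = let z∈R , z·y = ∈-filter⁻ y-nbr? {xs = R} z∈Y₀
                  in z·y , ¬-not (proj₂ (∈-filter⁻ (∁? x-nbr?) {xs = S} z∈R))
  T⊆S : T ⊆ S
  T⊆S = filter-⊆ (∁? x-nbr?) S ∘ filter-⊆ (∁? y-nbr?) R
  |S|≡ : length S ≡ length (map (_⊕ y) X₀) + (length (map (_⊕ x) Y₀) + length T)
  |S|≡ = begin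
    length S                           ≡⟨ length-filter+∁ x-nbr? S ⟩
    length X₀ + length R               ≡⟨ cong (length X₀ +_) (length-filter+∁ y-nbr? R) ⟩
    length X₀ + (length Y₀ + length T) ≡⟨ cong₂ (λ p q → p + (q + length T)) (length-map (_⊕ y) X₀) (length-map (_⊕ x) Y₀) ⟨
    length (map (_⊕ y) X₀) + (length (map (_⊕ x) Y₀) + length T) ∎
    where open ≡-Reasoning

module _ {n} .{{_ : NonZero n}} where

  isotropic-bound-⊆𝟎𝟏 : ∀ s {P : Pairs n} → IsHyperbolic P → n ≤ suc (2 * (s + length P)) →
                     ∀ {I} → TotallyIsotropicIn P I → All (λ z → z ≡ 𝟎 n ⊎ z ≡ 𝟏 n) I → length I ≤ 2 ^ s
  isotropic-bound-⊆𝟎𝟏 zero {P} hP dim {I} I-iso I⊆𝟎𝟏 = unique-⊆⇒length≤ unique I⊆𝟎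
    where
    open TotallyIsotropicIn I-iso
    𝟏·𝟏 : 𝟏 n · 𝟏 n ≡ true
    𝟏·𝟏 = subst (λ m → 𝟏 m · 𝟏 m ≡ true) (≤-antisym (hyperbolic-bound hP) dim) (𝟏·𝟏-odd (length P))
    I⊆𝟎 : I ⊆ [ 𝟎 n ]
    I⊆𝟎 z∈I with All.lookup I⊆𝟎𝟏 z∈I
    ... | inj₁ refl = here refl
    ... | inj₂ refl = contradiction (totallyIsotropic z∈I z∈I) (not-¬ 𝟏·𝟏)
  isotropic-bound-⊆𝟎𝟏 (suc s) _ _ I-iso I⊆𝟎𝟏 =
    ≤-trans (unique-⊆⇒length≤ (TotallyIsotropicIn.unique I-iso) I⊆𝟎𝟏′) (2≤2^suc s)
    where
    I⊆𝟎𝟏′ : _ ⊆ 𝟎 n ∷ 𝟏 n ∷ []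
    I⊆𝟎𝟏′ z∈I with All.lookup I⊆𝟎𝟏 z∈I
    ... | inj₁ refl = here refl
    ... | inj₂ refl = there (here refl)

  isotropic-bound : ∀ s {P : Pairs n} → IsHyperbolic P → n ≤ suc (2 * (s + length P)) →
                    ∀ {I} → TotallyIsotropicIn P I → length I ≤ 2 ^ s
  isotropic-bound s hP dim {I} I-iso with ⊆𝟎𝟏-or-∃ I
  ... | inj₁ I⊆𝟎𝟏 = isotropic-bound-⊆𝟎𝟏 s hP dim I-iso I⊆𝟎𝟏
  ... | inj₂ (x , x∈I , x≢𝟎 , x≢𝟏)
    with ∃-hyperbolic-extension hP (totallyIsotropic x∈I x∈I) (orthogonal x∈I) x≢𝟎 x≢𝟏
    where open TotallyIsotropicIn I-iso
  isotropic-bound zero hP dim I-iso | inj₂ _ | y , hP′ = contradiction dim (2*[1+k]<m⇒m≰1+2*k _ (hyperbolic-bound hP′))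
  isotropic-bound (suc s) {P} hP dim {I} I-iso | inj₂ (x , x∈I , _) | y , hP′
    with split-isotropic hP′ x∈I I-iso
  ... | I₀ , I₁ , |I|≡ , I₀-iso , I₁-iso = begin
    length I                ≡⟨ |I|≡ ⟩
    length I₀ + length I₁   ≤⟨ +-mono-≤-2* (isotropic-bound s hP′ dim′ I₀-iso) (isotropic-bound s hP′ dim′ I₁-iso) ⟩
    2 ^ suc s               ∎
    where
    open ≤-Reasoning
    dim′ = ≤-shift-suc s (length P) dim

  triangle-free-bound : ∀ s e → e ≤ 1 → ∀ {P : Pairs n} → IsHyperbolic P → n + e ≤ suc (2 * (s + length P)) →
                        ∀ {S} → TriangleFreeIn P S → length S + e < 2 ^ suc s
  triangle-free-bound s e e≤1 hP dim {S} S-tf with totallyIsotropic-or-edge S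
  ... | inj₁ S-iso = begin-strict
    length S + e   <⟨ +-mono-≤-< (isotropic-bound s hP (≤-trans (m≤m+n n e) dim) S-iso′)
                                   (parity-slack s _ e≤1 (hyperbolic-bound hP) dim) ⟩
    2 ^ s + 2 ^ s  ≡⟨ m+m≡2*m (2 ^ s) ⟩
    2 ^ suc s      ∎
    where
    open ≤-Reasoning
    open TriangleFreeIn S-tf
    S-iso′ : TotallyIsotropicIn _ S
    S-iso′ = record { unique = unique ; orthogonal = orthogonal ; totallyIsotropic = S-iso }
  ... | inj₂ (x , y , x∈S , y∈S , x·y) with
    extend {a = x} {b = y} (isotropic x∈S) (isotropic y∈S) x·y (orthogonal x∈S) (orthogonal y∈S) hP
    where open TriangleFreeIn S-tf
  triangle-free-bound zero e _ hP dim S-tf | inj₂ _ | hP′ =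
    contradiction (≤-trans (m≤m+n n e) dim) (2*[1+k]<m⇒m≰1+2*k _ (hyperbolic-bound hP′))
  triangle-free-bound (suc s) e e≤1 {P} hP dim {S} S-tf | inj₂ (x , y , x∈S , y∈S , _) | hP′
    with split-triangle-free hP′ x∈S y∈S S-tf
  ... | X , Y , T , |S|≡ , X-iso , Y-iso , T-tf = begin-strict
    length S + e                                 ≡⟨ cong (_+ e) |S|≡ ⟩
    length X + (length Y + length T) + e         ≡⟨ cong (_+ e) (+-assoc (length X) (length Y) (length T)) ⟨
    length X + length Y + length T + e           ≡⟨ +-assoc (length X + length Y) (length T) e ⟩
    (length X + length Y) + (length T + e)       <⟨ +-mono-≤-< (+-mono-≤-2* (isotropic-bound s hP′ dim′ X-iso)
                                                                           (isotropic-bound s (swap-hyperbolic hP′) dim′ Y-iso))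
                                                               (triangle-free-bound s e e≤1 hP′ (≤-shift-suc s (length P) dim) T-tf) ⟩
    2 ^ suc s + 2 ^ suc s                        ≡⟨ m+m≡2*m (2 ^ suc s) ⟩
    2 ^ suc (suc s)                              ∎
    where
    open ≤-Reasoning
    dim′ = ≤-shift-suc s (length P) (≤-trans (m≤m+n n e) dim)

triangleFreeIn-𝟎∷ : ∀ {S : List (Vec Bool n)} → Unique S → All (λ x → x ≢ 𝟎 n) S → All Isotropic S →
                    TriangleFree S → TriangleFreeIn [] (𝟎 n ∷ S)
triangleFreeIn-𝟎∷ {n} uS S≢𝟎 S-iso tf = record
  { unique       = All.map (λ x≢𝟎 𝟎≡x → x≢𝟎 (sym 𝟎≡x)) S≢𝟎 ∷ uS
  ; orthogonal   = λ _ → []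
  ; isotropic    = λ { (here refl) → ·-zeroʳ (𝟎 n) ; (there z∈S) → All.lookup S-iso z∈S }
  ; triangleFree = triangleFree-𝟎∷ tf
  }

proposition6p4 : (n : ℕ) → 1 ≤ n → (S : List (Vec Bool n)) → Unique S →
    Is32Orthogonal S → All (λ x → x · x ≡ false) S →
    (∀ k → n ≡ 2 * k + 1 → length S + 2 ≤ 2 ^ (k + 1)) ×
    (∀ k → n ≡ 2 * k → length S + 3 ≤ 2 ^ (k + 1))
proposition6p4 n 1≤n S uS (S≢𝟎 , tf) S-iso =
  (λ k n≡2k+1 → subst (_≤ 2 ^ (k + 1)) (+-identityʳ (length S + 2)) (bound k 0 z≤n (trans (+-identityʳ n) n≡2k+1))) ,
  (λ k n≡2k → subst (_≤ 2 ^ (k + 1)) (+-assoc (length S) 2 1) (bound k 1 (s≤s z≤n) (cong (_+ 1) n≡2k)))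
  where
  instance
    _ : NonZero n
    _ = >-nonZero 1≤n
  bound : ∀ k e → e ≤ 1 → n + e ≡ 2 * k + 1 → length S + 2 + e ≤ 2 ^ (k + 1)
  bound k e e≤1 n+e≡ = subst₂ _≤_ (cong (_+ e) (+-comm 2 (length S))) (cong (2 ^_) (+-comm 1 k))
    (triangle-free-bound k e e≤1 [] dim (triangleFreeIn-𝟎∷ uS S≢𝟎 S-iso tf))
    where
    dim : n + e ≤ suc (2 * (k + 0))
    dim = ≤-reflexive (trans n+e≡ (trans (+-comm (2 * k) 1) (cong (λ m → suc (2 * m)) (sym (+-identityʳ k)))))
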